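{- Let $G$ be a simple graph on $n\geq 2$ vertices, none of which is isolated, with $m$ edges. Then for every positive integer $k$, $$r(G,F_k)\leq n+2mk-\frac{2m}{n}.$$
   Context: For graphs $G$ and $H$, the Ramsey number $r(G,H)$ is the smallest positive integer $N$ such that every red-blue coloring of the edges of $K_N$ contains a red subgraph isomorphic to $G$ or a blue subgraph isomorphic to $H$. The fan $F_k$ is the graph consisting of $k$ triangles sharing one common vertex, i.e. $F_k=K_1+kK_2$. -}

module Defs where

open import Data.Nat using (ℕ; zero; suc; _+_; _*_; _<_; _≤_)
open import Data.Nat.Properties using (_<?_)
open import Data.Bool using (Bool; true; false; if_then_else_)
open import Data.Fin using (Fin; toℕ)
open import Data.Fin.Properties using ()
open import Data.Product using (Σ; ∃; _×_; _,_)
open import Data.Sum using (_⊎_)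
open import Data.Empty using (⊥)
open import Relation.Binary.PropositionalEquality using (_≡_; _≢_)
open import Relation.Nullary using (¬_; does)
open import Function.Definitions using (Injective)
open import Data.List using (List; map; allFin)
open import Data.Nat.ListAction using (sum)

record SimpleGraph (n : ℕ) : Set where
  field
    adj   : Fin n → Fin n → Bool
    sym   : ∀ i j → adj i j ≡ adj j i
    loopless : ∀ i → adj i i ≡ false
open SimpleGraph public

boolToℕ : Bool → ℕ
boolToℕ true  = 1
boolToℕ false = 0

edgeCount : ∀ {n} → SimpleGraph n → ℕ
edgeCount {n} G =
  sum (map (λ i → sum (map (λ j →
    if does (toℕ i <? toℕ j) then boolToℕ (adj G i j) else 0) (allFin n))) (allFin n))

Isolated : ∀ {n} → SimpleGraph n → Fin n → Set
Isolated G v = ∀ w → adj G v w ≡ false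

-- Red/blue colourings of the edges of K_N: a symmetric colour function on
-- pairs of vertices (true = red, false = blue); the value on the diagonal
-- is irrelevant.
record Colouring (N : ℕ) : Set where
  field
    col    : Fin N → Fin N → Bool
    colSym : ∀ i j → col i j ≡ col j i
open Colouring public

ContainsIn : ∀ {N n} → Colouring N → Bool → SimpleGraph n → Set
ContainsIn {N} {n} c b G =
  Σ (Fin n → Fin N) λ f → Injective _≡_ _≡_ f ×
    (∀ i j → adj G i j ≡ true → col c (f i) (f j) ≡ b)

Arrows : ∀ {n p} → ℕ → SimpleGraph n → SimpleGraph p → Set
Arrows N G H = (c : Colouring N) → ContainsIn c true G ⊎ ContainsIn c false H

IsRamseyNumber : ∀ {n p} → SimpleGraph n → SimpleGraph p → ℕ → Set
IsRamseyNumber G H N =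
  (0 < N) × Arrows N G H × (∀ M → 0 < M → M < N → ¬ Arrows M G H)

-- The fan F_k = K_1 + k K_2 on vertex set Fin (1 + 2k): vertex 0 is the
-- centre, adjacent to all others; vertices 2i+1 and 2i+2 are adjacent
-- (i < k).
fanAdjℕ : ℕ → ℕ → Bool
fanAdjℕ zero zero = false
fanAdjℕ zero (suc _) = true
fanAdjℕ (suc _) zero = true
fanAdjℕ (suc a) (suc b) = pairAdj a b
  where
  pairAdj : ℕ → ℕ → Bool
  pairAdj zero (suc zero) = true
  pairAdj (suc zero) zero = true
  pairAdj (suc (suc x)) (suc (suc y)) = pairAdj x y
  pairAdj _ _ = false

fanAdj-sym : ∀ a b → fanAdjℕ a b ≡ fanAdjℕ b a
fanAdj-sym zero zero = _≡_.refl
fanAdj-sym zero (suc b) = _≡_.refl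
fanAdj-sym (suc a) zero = _≡_.refl
fanAdj-sym (suc a) (suc b) = go a b
  where
  go : ∀ a b → fanAdjℕ (suc a) (suc b) ≡ fanAdjℕ (suc b) (suc a)
  go zero zero = _≡_.refl
  go zero (suc zero) = _≡_.refl
  go zero (suc (suc b)) = _≡_.refl
  go (suc zero) zero = _≡_.refl
  go (suc (suc a)) zero = _≡_.refl
  go (suc zero) (suc zero) = _≡_.refl
  go (suc zero) (suc (suc b)) = _≡_.refl
  go (suc (suc a)) (suc zero) = _≡_.refl
  go (suc (suc a)) (suc (suc b)) = go a b

fanAdj-irr : ∀ a → fanAdjℕ a a ≡ false
fanAdj-irr zero = _≡_.refl
fanAdj-irr (suc a) = go a
  where
  go : ∀ a → fanAdjℕ (suc a) (suc a) ≡ false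
  go zero = _≡_.refl
  go (suc zero) = _≡_.refl
  go (suc (suc a)) = go a

Fan : (k : ℕ) → SimpleGraph (suc (2 * k))
Fan k = record
  { adj = λ i j → fanAdjℕ (toℕ i) (toℕ j)
  ; sym = λ i j → fanAdj-sym (toℕ i) (toℕ j)
  ; loopless = λ i → fanAdj-irr (toℕ i)
  }

module Submission where

-- Greedy embedding.  Write A = 2m and let c be a red/blue colouring of K_N.  Embed G into the
-- red graph vertex by vertex: remove a vertex v of minimum degree d from the current graph H
-- on i + 1 vertices (so (i + 1) d ≤ A and d ≤ i) and embed H - v first.  If an embedded
-- neighbour y of v has at least (i + 1) + 2(k - 1) blue neighbours, extracting blue edges
-- among them one at a time yields either k disjoint blue edges, i.e. a blue F_k centred at
-- y, or a red K_(i+1), which contains H.  Otherwise the i images together with the blue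
-- neighbourhoods of the d embedded neighbours of v cover at most i + d (i + 2k - 2) vertices,
-- so v can be sent to any other vertex.  For N = ⌊(n² + Akn - A) / n⌋ there is always such a
-- vertex, because (i + 1 + d (i + 2k - 2)) n + A ≤ n² + Akn.  Finally, K_M → (G, F_k) is
-- decidable by exhaustive search, so the least such M exists and is at most N.

open import Data.Nat.Properties hiding (_≟_)
open import Algebra.Properties.Semiring.Sum +-*-semiring
  using (sum; sum-syntax; sum-cong-≗; sum-remove; ∑-distrib-+; ∑-comm; *-distribʳ-sum)
open import Data.Bool using (Bool; true; false; _∧_; _∨_; not; if_then_else_)
open import Data.Bool.Properties
  using (∧-zeroʳ; ∧-identityʳ; ∧-conicalˡ; ∧-conicalʳ; ∨-conicalˡ; ∨-conicalʳ; ¬-not; not-injective)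
  renaming (_≟_ to _≟ᵇ_)
open import Data.Fin using (Fin; zero; suc; punchIn; punchOut; toℕ; cast; _≟_)
open import Data.Fin.Properties
  using (any?; all?; punchInᵢ≢i; punchIn-punchOut; toℕ-injective; toℕ-cast)
import Data.List as List using (map; tabulate; allFin)
open import Data.List.Properties using (map-tabulate)
open import Data.Nat using (ℕ; NonZero; zero; suc; _+_; _*_; _∸_; _≤_; _<_; z≤n; s≤s; s≤s⁻¹)
open import Data.Nat.DivMod using (_/_; m*n/n≡m; m/n*n≤m; /-monoˡ-≤)
open import Data.Nat.Induction using (<-rec)
import Data.Nat.ListAction as List using (sum)
open import Data.Nat.Tactic.RingSolver using (solve-∀)
open import Data.Product using (Σ; ∃; ∃₂; _×_; _,_)
import Data.Product as Product
open import Data.Sum using (_⊎_; inj₁; inj₂)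
import Data.Sum as Sum
open import Data.Vec.Functional using ([]; _∷_; insertAt)
open import Data.Vec.Functional.Properties using (insertAt-lookup; insertAt-punchIn)
open import Data.Vec.Functional.Relation.Binary.Pointwise using (Pointwise)
open import Function using (_∘_; _∘₂_; id; case_of_)
open import Function.Definitions using (Injective)
open import Level using (0ℓ)
open import Relation.Binary using (Rel; Reflexive; _Respects_; tri<; tri≈; tri>)
open import Relation.Binary.PropositionalEquality
open import Relation.Nullary using (¬_; Dec; does; yes; no; contradiction)
open import Relation.Nullary.Decidable
  using (dec-true; dec-false; _×-dec_; _⊎-dec_; _→-dec_; ¬?; map′; decidable-stable)
open import Relation.Unary using (Pred; Decidable)

open import Defs hiding (sym)

∑-mono-≤ : ∀ {n} {f g : Fin n → ℕ} → (∀ i → f i ≤ g i) → sum f ≤ sum g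
∑-mono-≤ {zero}  _   = z≤n
∑-mono-≤ {suc n} f≤g = +-mono-≤ (f≤g zero) (∑-mono-≤ (f≤g ∘ suc))

∑-const : ∀ n c → ∑[ i < n ] c ≡ n * c
∑-const zero    c = refl
∑-const (suc n) c = cong (c +_) (∑-const n c)

≤-∑ : ∀ {n} (f : Fin n → ℕ) i → f i ≤ sum f
≤-∑ {suc n} f i = ≤-trans (m≤m+n (f i) _) (≤-reflexive (sym (sum-remove {i = i} f)))

∑-punchIn-≤ : ∀ {n} (f : Fin (suc n) → ℕ) v → ∑[ a < n ] f (punchIn v a) ≤ sum f
∑-punchIn-≤ f v = ≤-trans (m≤n+m _ (f v)) (≤-reflexive (sym (sum-remove {i = v} f)))

∑<n⇒∃≡0 : ∀ {n} (f : Fin n → ℕ) → sum f < n → ∃ λ i → f i ≡ 0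
∑<n⇒∃≡0 {suc n} f ∑f<n with f zero in eq
... | zero  = zero , eq
... | suc m = Product.map suc id (∑<n⇒∃≡0 (f ∘ suc) (≤-trans (s≤s (m≤n+m _ m)) (s≤s⁻¹ ∑f<n)))

argmin : ∀ {n} (f : Fin (suc n) → ℕ) → ∃ λ v → ∀ x → f v ≤ f x
argmin {zero}  f = zero , λ { zero → ≤-refl }
argmin {suc n} f with argmin (f ∘ suc)
... | v , min with f zero ≤? f (suc v)
...   | yes f0≤ = zero  , λ { zero → ≤-refl ; (suc x) → ≤-trans f0≤ (min x) }
...   | no  f0≰ = suc v , λ { zero → ≰⇒≥ f0≰ ; (suc x) → min x }

∃-≤-mean : ∀ {n} (f : Fin (suc n) → ℕ) → ∃ λ v → suc n * f v ≤ sum f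
∃-≤-mean {n} f =
  Product.map₂ (λ min → ≤-trans (≤-reflexive (sym (∑-const (suc n) _))) (∑-mono-≤ min)) (argmin f)

sum-tabulate : ∀ {n} (f : Fin n → ℕ) → List.sum (List.tabulate f) ≡ sum f
sum-tabulate {zero}  f = refl
sum-tabulate {suc n} f = cong (f zero +_) (sum-tabulate (f ∘ suc))

sum-map-allFin : ∀ {n} (f : Fin n → ℕ) → List.sum (List.map f (List.allFin n)) ≡ sum f
sum-map-allFin f = trans (cong List.sum (map-tabulate id f)) (sum-tabulate f)

boolToℕ≤1 : ∀ b → boolToℕ b ≤ 1
boolToℕ≤1 true  = ≤-refl
boolToℕ≤1 false = z≤n

boolToℕ-∨ : ∀ a b → boolToℕ (a ∨ b) ≤ boolToℕ a + boolToℕ b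
boolToℕ-∨ true  _ = s≤s z≤n
boolToℕ-∨ false _ = ≤-refl

boolToℕ≡0⇒false : ∀ {b} → boolToℕ b ≡ 0 → b ≡ false
boolToℕ≡0⇒false {false} _ = refl

count : ∀ {N} → (Fin N → Bool) → ℕ
count {N} T = ∑[ w < N ] boolToℕ (T w)

_≡ᵇ_ : ∀ {N} → Fin N → Fin N → Bool
x ≡ᵇ y = does (x ≟ y)

≡ᵇ≡false⇒≢ : ∀ {N} {x y : Fin N} → (x ≡ᵇ y) ≡ false → x ≢ y
≡ᵇ≡false⇒≢ {x = x} x≢ᵇy refl = case trans (sym x≢ᵇy) (dec-true (x ≟ x) refl) of λ ()

_∖_ : ∀ {N} → (Fin N → Bool) → Fin N → (Fin N → Bool)
(T ∖ x) w = T w ∧ not (w ≡ᵇ x)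

module _ {N : ℕ} (T : Fin N → Bool) where

  count≤N : count T ≤ N
  count≤N = ≤-trans (∑-mono-≤ (boolToℕ≤1 ∘ T)) (≤-reflexive (trans (∑-const N 1) (*-identityʳ N)))

  ∖-⊆ : ∀ {x w} → (T ∖ x) w ≡ true → T w ≡ true
  ∖-⊆ {w = w} = ∧-conicalˡ (T w) _

  ∖-≢ : ∀ {x w} → (T ∖ x) w ≡ true → w ≢ x
  ∖-≢ {w = w} T∖x[w] = ≡ᵇ≡false⇒≢ (not-injective (∧-conicalʳ (T w) _ T∖x[w]))

  ∖-self : ∀ x → (T ∖ x) x ≡ false
  ∖-self x = trans (cong (λ b → T x ∧ not b) (dec-true (x ≟ x) refl)) (∧-zeroʳ (T x))

  ∖-≢-eq : ∀ {x w} → w ≢ x → (T ∖ x) w ≡ T w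
  ∖-≢-eq {x} {w} w≢x = trans (cong (λ b → T w ∧ not b) (dec-false (w ≟ x) w≢x)) (∧-identityʳ (T w))

count-∖ : ∀ {N} (T : Fin N → Bool) {x} → T x ≡ true → count T ≡ suc (count (T ∖ x))
count-∖ {suc N} T {x} Tx = begin
  count T                                            ≡⟨ sum-remove {i = x} (boolToℕ ∘ T) ⟩
  boolToℕ (T x) + ∑[ a < N ] boolToℕ (T (x⁺ a))
    ≡⟨ cong₂ (λ b c → boolToℕ b + c) Tx
             (sum-cong-≗ (cong boolToℕ ∘ sym ∘ ∖-≢-eq T ∘ punchInᵢ≢i x)) ⟩
  suc (∑[ a < N ] boolToℕ ((T ∖ x) (x⁺ a)))
    ≡⟨ cong (λ b → suc (boolToℕ b + ∑[ a < N ] boolToℕ ((T ∖ x) (x⁺ a)))) (∖-self T x) ⟨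
  suc (boolToℕ ((T ∖ x) x) + ∑[ a < N ] boolToℕ ((T ∖ x) (x⁺ a)))
    ≡⟨ cong suc (sum-remove {i = x} (boolToℕ ∘ (T ∖ x))) ⟨
  suc (count (T ∖ x))                                ∎
  where
  open ≡-Reasoning
  x⁺ : Fin N → Fin (suc N)
  x⁺ = punchIn x

count>0⇒∃ : ∀ {N} (T : Fin N → Bool) → 0 < count T → ∃ λ x → T x ≡ true
count>0⇒∃ {suc N} T 0<count with T zero in eq
... | true  = zero , eq
... | false = Product.map suc id (count>0⇒∃ (T ∘ suc) 0<count)

count-∨ : ∀ {N} (S T : Fin N → Bool) → count (λ w → S w ∨ T w) ≤ count S + count T
count-∨ S T =
  ≤-trans (∑-mono-≤ (λ w → boolToℕ-∨ (S w) (T w)))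
          (≤-reflexive (∑-distrib-+ (boolToℕ ∘ S) (boolToℕ ∘ T)))

count-≡ᵇ : ∀ {N} (y : Fin N) → count (_≡ᵇ y) ≡ 1
count-≡ᵇ {suc N} y = begin
  count (_≡ᵇ y)                                       ≡⟨ sum-remove {i = y} (boolToℕ ∘ (_≡ᵇ y)) ⟩
  boolToℕ (y ≡ᵇ y) + ∑[ a < N ] boolToℕ (punchIn y a ≡ᵇ y)
    ≡⟨ cong₂ _+_ (cong boolToℕ (dec-true (y ≟ y) refl))
                 (sum-cong-≗ (cong boolToℕ ∘ dec-false (_ ≟ y) ∘ punchInᵢ≢i y)) ⟩
  1 + ∑[ a < N ] 0                                     ≡⟨ cong suc (trans (∑-const N 0) (*-zeroʳ N)) ⟩
  1                                                   ∎
  where open ≡-Reasoning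

∃-outside : ∀ {i N} (S : Fin i → Fin N → Bool) → ∑[ u < i ] count (S u) < N →
  ∃ λ w → ∀ u → S u w ≡ false
∃-outside {i} {N} S small
  with w , ∑≡0 ← ∑<n⇒∃≡0 (λ w → ∑[ u < i ] boolToℕ (S u w))
                          (subst (_< N) (∑-comm (boolToℕ ∘₂ S)) small)
  = w , λ u → boolToℕ≡0⇒false (n≤0⇒n≡0 (≤-trans (≤-∑ (λ u → boolToℕ (S u w)) u) (≤-reflexive ∑≡0)))

∷-injective : ∀ {m N} {x : Fin N} {f : Fin m → Fin N} →
  Injective _≡_ _≡_ f → (∀ a → f a ≢ x) → Injective _≡_ _≡_ (x ∷ f)
∷-injective inj f≢x {zero}  {zero}  _   = refl
∷-injective inj f≢x {zero}  {suc b} x≡f = contradiction (sym x≡f) (f≢x b)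
∷-injective inj f≢x {suc a} {zero}  f≡x = contradiction f≡x (f≢x a)
∷-injective inj f≢x {suc a} {suc b} f≡f = cong suc (inj f≡f)

≤count⇒injection : ∀ {N} s (T : Fin N → Bool) → s ≤ count T →
  Σ (Fin s → Fin N) λ f → Injective _≡_ _≡_ f × (∀ a → T (f a) ≡ true)
≤count⇒injection zero    T _ = [] , (λ { {()} }) , (λ ())
≤count⇒injection (suc s) T s<count with x , Tx ← count>0⇒∃ T (≤-trans (s≤s z≤n) s<count)
  with f , inj , Tf ← ≤count⇒injection s (T ∖ x) (s≤s⁻¹ (≤-trans s<count (≤-reflexive (count-∖ T Tx))))
  = x ∷ f , ∷-injective inj (λ a → ∖-≢ T (Tf a)) , λ { zero → Tx ; (suc a) → ∖-⊆ T (Tf a) }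

module _ {n : ℕ} (G : SimpleGraph n) where

  degree : Fin n → ℕ
  degree x = count (adj G x)

  degreeSum : ℕ
  degreeSum = ∑[ x < n ] degree x

  adj⇒≢ : ∀ {x y} → adj G x y ≡ true → x ≢ y
  adj⇒≢ {x} e refl = case trans (sym e) (loopless G x) of λ ()

  handshake : degreeSum ≡ 2 * edgeCount G
  handshake = begin
    ∑[ x < n ] ∑[ y < n ] boolToℕ (adj G x y)        ≡⟨ sum-cong-≗ (λ x → sum-cong-≗ (split x)) ⟩
    ∑[ x < n ] ∑[ y < n ] (e x y + e y x)            ≡⟨ sum-cong-≗ (λ x → ∑-distrib-+ (e x) (λ y → e y x)) ⟩
    ∑[ x < n ] (∑[ y < n ] e x y + ∑[ y < n ] e y x)
      ≡⟨ ∑-distrib-+ (λ x → ∑[ y < n ] e x y) (λ x → ∑[ y < n ] e y x) ⟩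
    E + ∑[ x < n ] ∑[ y < n ] e y x                  ≡⟨ cong (E +_) (∑-comm (λ x y → e y x)) ⟩
    E + E                                            ≡⟨ cong (E +_) (+-identityʳ E) ⟨
    2 * E                                            ≡⟨ cong (2 *_) edgeCount≡E ⟨
    2 * edgeCount G                                  ∎
    where
    open ≡-Reasoning
    e : Fin n → Fin n → ℕ
    e x y = if does (toℕ x <? toℕ y) then boolToℕ (adj G x y) else 0
    E : ℕ
    E = ∑[ x < n ] ∑[ y < n ] e x y
    edgeCount≡E : edgeCount G ≡ E
    edgeCount≡E = trans (sum-map-allFin (λ x → List.sum (List.map (e x) (List.allFin n))))
                        (sum-cong-≗ (λ x → sum-map-allFin (e x)))
    split : ∀ x y → boolToℕ (adj G x y) ≡ e x y + e y x
    split x y with <-cmp (toℕ x) (toℕ y)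
    ... | tri< x<y _ y≮x
      rewrite dec-true (toℕ x <? toℕ y) x<y | dec-false (toℕ y <? toℕ x) y≮x = sym (+-identityʳ _)
    ... | tri> x≮y _ y<x
      rewrite dec-false (toℕ x <? toℕ y) x≮y | dec-true (toℕ y <? toℕ x) y<x =
        cong boolToℕ (SimpleGraph.sym G x y)
    ... | tri≈ x≮y x≡y _ with refl ← toℕ-injective x≡y
      rewrite dec-false (toℕ x <? toℕ x) x≮y | loopless G x = refl

deleteVertex : ∀ {n} → SimpleGraph (suc n) → Fin (suc n) → SimpleGraph n
deleteVertex G v = record
  { adj      = λ a b → adj G (punchIn v a) (punchIn v b)
  ; sym      = λ a b → SimpleGraph.sym G (punchIn v a) (punchIn v b)
  ; loopless = loopless G ∘ punchIn v
  }

module _ {n : ℕ} (G : SimpleGraph (suc n)) (v : Fin (suc n)) where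

  degreeSum-deleteVertex : degreeSum (deleteVertex G v) ≤ degreeSum G
  degreeSum-deleteVertex =
    ≤-trans (∑-mono-≤ (λ a → ∑-punchIn-≤ (boolToℕ ∘ adj G (punchIn v a)) v))
            (∑-punchIn-≤ (degree G) v)

  degree≡count-punchIn : degree G v ≡ count (adj G v ∘ punchIn v)
  degree≡count-punchIn = trans (sum-remove {i = v} (boolToℕ ∘ adj G v))
    (cong (λ b → boolToℕ b + count (adj G v ∘ punchIn v)) (loopless G v))

data PunchInView {n} (v : Fin (suc n)) : Fin (suc n) → Set where
  at    : PunchInView v v
  other : ∀ a → PunchInView v (punchIn v a)

punchInView : ∀ {n} (v x : Fin (suc n)) → PunchInView v x
punchInView v x with v ≟ x
... | yes refl = at
... | no  v≢x  = subst (PunchInView v) (punchIn-punchOut v≢x) (other (punchOut v≢x))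

-- Matchings are built one edge at a time, and double (suc j) reduces to suc (suc (double j))
-- where 2 * suc j does not.
double : ℕ → ℕ
double zero    = zero
double (suc j) = suc (suc (double j))

double≡2* : ∀ j → double j ≡ 2 * j
double≡2* zero    = refl
double≡2* (suc j) = cong suc (trans (cong suc (double≡2* j)) (sym (+-suc j (j + 0))))

-- Room for one greedy step towards a red G or a blue F_(k+1): a vertex of degree d in a graph
-- on i + 1 vertices (of minimum degree, so (i + 1) d ≤ A) must avoid the i embedded vertices
-- and the blue neighbourhoods, each of size at most i + 2k, of its d embedded neighbours.
GreedyRoom : ℕ → ℕ → ℕ → ℕ → Set
GreedyRoom N k n A = ∀ i d → i < n → suc i * d ≤ A → d ≤ i → suc i + d * (i + 2 * k) ≤ N

module _ {N : ℕ} (c : Colouring N) where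

  blueNbhd : Fin N → Fin N → Bool
  blueNbhd y w = not (w ≡ᵇ y) ∧ not (col c y w)

  blueNbhd⇒≢ : ∀ {y w} → blueNbhd y w ≡ true → w ≢ y
  blueNbhd⇒≢ w∈ = ≡ᵇ≡false⇒≢ (not-injective (∧-conicalˡ _ _ w∈))

  blueNbhd⇒blue : ∀ {y w} → blueNbhd y w ≡ true → col c y w ≡ false
  blueNbhd⇒blue w∈ = not-injective (∧-conicalʳ _ _ w∈)

  ∉blueNbhd⇒red : ∀ {y w} → w ≢ y → blueNbhd y w ≡ false → col c y w ≡ true
  ∉blueNbhd⇒red {y} {w} w≢y w∉ rewrite dec-false (w ≟ y) w≢y = not-injective w∉

  RedClique : ℕ → Set
  RedClique s = Σ (Fin s → Fin N) λ Q →
    Injective _≡_ _≡_ Q × (∀ a b → a ≢ b → col c (Q a) (Q b) ≡ true)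

  redClique⇒red : ∀ {n} → RedClique n → (G : SimpleGraph n) → ContainsIn c true G
  redClique⇒red (Q , inj , red) G = Q , inj , λ a b e → red a b (adj⇒≢ G e)

  -- fanAdjℕ (suc a) (suc b) is the perfect matching {0,1}, {2,3}, … on the rim of the fan.
  RimBlue : ∀ {m} → (Fin m → Fin N) → Set
  RimBlue h = ∀ a b → fanAdjℕ (suc (toℕ a)) (suc (toℕ b)) ≡ true → col c (h a) (h b) ≡ false

  BlueMatching : ℕ → (Fin N → Bool) → Set
  BlueMatching j T = Σ (Fin (double j) → Fin N) λ h →
    Injective _≡_ _≡_ h × (∀ a → T (h a) ≡ true) × RimBlue h

  noBlueMatching : ∀ T → BlueMatching 0 T
  noBlueMatching _ = [] , (λ { {()} }) , (λ ()) , (λ ())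

  BluePair : (Fin N → Bool) → Fin N → Fin N → Set
  BluePair T a b = T a ≡ true × T b ≡ true × b ≢ a × col c a b ≡ false

  bluePair? : ∀ T → Dec (∃₂ (BluePair T))
  bluePair? T = any? λ a → any? λ b →
    (T a ≟ᵇ true) ×-dec (T b ≟ᵇ true) ×-dec ¬? (b ≟ a) ×-dec (col c a b ≟ᵇ false)

  addBlueEdge : ∀ {j T a b} → BluePair T a b → BlueMatching j ((T ∖ a) ∖ b) → BlueMatching (suc j) T
  addBlueEdge {T = T} {a} {b} (Ta , Tb , b≢a , ab-blue) (h , inj , Th , rim) =
    a ∷ b ∷ h , ∷-injective (∷-injective inj (λ x → ∖-≢ (T ∖ a) (Th x))) ≢a , inT , rim′
    where
    ≢a : ∀ x → (b ∷ h) x ≢ a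
    ≢a zero    = b≢a
    ≢a (suc x) = ∖-≢ T (∖-⊆ (T ∖ a) (Th x))
    inT : ∀ x → T ((a ∷ b ∷ h) x) ≡ true
    inT zero          = Ta
    inT (suc zero)    = Tb
    inT (suc (suc x)) = ∖-⊆ T (∖-⊆ (T ∖ a) (Th x))
    rim′ : RimBlue (a ∷ b ∷ h)
    rim′ zero          zero          ()
    rim′ zero          (suc zero)    _ = ab-blue
    rim′ zero          (suc (suc y)) ()
    rim′ (suc zero)    zero          _ = trans (colSym c b a) ab-blue
    rim′ (suc zero)    (suc zero)    ()
    rim′ (suc zero)    (suc (suc y)) ()
    rim′ (suc (suc x)) zero          ()
    rim′ (suc (suc x)) (suc zero)    ()
    rim′ (suc (suc x)) (suc (suc y)) e = rim x y e

  cliqueOrMatching : ∀ s j (T : Fin N → Bool) → s + double j ≤ count T →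
    RedClique s ⊎ BlueMatching (suc j) T
  cliqueOrMatching s j T big with bluePair? T
  ... | no ∄pair with Q , inj , TQ ← ≤count⇒injection s T (≤-trans (m≤m+n s (double j)) big) =
    inj₁ (Q , inj , λ a b a≢b → ¬-not λ blue → ∄pair (Q a , Q b , TQ a , TQ b , a≢b ∘ inj ∘ sym , blue))
  cliqueOrMatching s zero    T big | yes (a , b , pair) =
    inj₂ (addBlueEdge {T = T} pair (noBlueMatching ((T ∖ a) ∖ b)))
  cliqueOrMatching s (suc j) T big | yes (a , b , pair@(Ta , Tb , b≢a , _)) =
    Sum.map₂ (addBlueEdge {T = T} pair) (cliqueOrMatching s j ((T ∖ a) ∖ b) big′)
    where
    count≡ : count T ≡ suc (suc (count ((T ∖ a) ∖ b)))
    count≡ = trans (count-∖ T Ta) (cong suc (count-∖ (T ∖ a) (trans (∖-≢-eq T b≢a) Tb)))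
    big′ : s + double j ≤ count ((T ∖ a) ∖ b)
    big′ = s≤s⁻¹ (s≤s⁻¹ (subst₂ _≤_ (trans (+-suc s _) (cong suc (+-suc s _))) count≡ big))

  blueMatching⇒fan : ∀ k y → BlueMatching k (blueNbhd y) → ContainsIn c false (Fan k)
  blueMatching⇒fan k y (h , inj , inNbhd , rim) =
    y ∷ h ∘ ι , ∷-injective h∘ι-injective (λ a → blueNbhd⇒≢ (inNbhd (ι a))) , blue
    where
    ι : Fin (2 * k) → Fin (double k)
    ι = cast (sym (double≡2* k))
    h∘ι-injective : Injective _≡_ _≡_ (h ∘ ι)
    h∘ι-injective {a} {b} e =
      toℕ-injective (trans (sym (toℕ-cast _ a)) (trans (cong toℕ (inj e)) (toℕ-cast _ b)))
    blue : ∀ a b → adj (Fan k) a b ≡ true → col c ((y ∷ h ∘ ι) a) ((y ∷ h ∘ ι) b) ≡ false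
    blue zero    zero    ()
    blue zero    (suc b) _ = blueNbhd⇒blue (inNbhd (ι b))
    blue (suc a) zero    _ = trans (colSym c _ y) (blueNbhd⇒blue (inNbhd (ι a)))
    blue (suc a) (suc b) e = rim (ι a) (ι b)
      (subst₂ (λ u v → fanAdjℕ (suc u) (suc v) ≡ true) (sym (toℕ-cast _ a)) (sym (toℕ-cast _ b)) e)

  largeBlueNbhd⇒redOrFan : ∀ {n} (G : SimpleGraph n) k y → n + 2 * k ≤ count (blueNbhd y) →
    ContainsIn c true G ⊎ ContainsIn c false (Fan (suc k))
  largeBlueNbhd⇒redOrFan {n} G k y big =
    Sum.map (λ Q → redClique⇒red Q G) (blueMatching⇒fan (suc k) y)
      (cliqueOrMatching n k (blueNbhd y) (subst (λ x → n + x ≤ count (blueNbhd y)) (sym (double≡2* k)) big))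

  extendRedCopy : ∀ {i} (G : SimpleGraph (suc i)) v → ((f , _) : ContainsIn c true (deleteVertex G v)) →
    ∀ w → (∀ u → w ≢ f u) → (∀ u → adj G v (punchIn v u) ≡ true → col c (f u) w ≡ true) →
    ContainsIn c true G
  extendRedCopy {i} G v (f , inj , red) w w∉ w-red = g , g-injective , g-red
    where
    g : Fin (suc i) → Fin N
    g = insertAt f v w
    g[v] : g v ≡ w
    g[v] = insertAt-lookup f v w
    g∘punchIn : ∀ a → g (punchIn v a) ≡ f a
    g∘punchIn = insertAt-punchIn f v w
    g-injective : Injective _≡_ _≡_ g
    g-injective {x} {y} gx≡gy with punchInView v x | punchInView v y
    ... | at      | at      = refl
    ... | at      | other b = contradiction (trans (sym g[v]) (trans gx≡gy (g∘punchIn b))) (w∉ b)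
    ... | other a | at      = contradiction (trans (sym g[v]) (trans (sym gx≡gy) (g∘punchIn a))) (w∉ a)
    ... | other a | other b = cong (punchIn v) (inj (trans (sym (g∘punchIn a)) (trans gx≡gy (g∘punchIn b))))
    g-red : ∀ x y → adj G x y ≡ true → col c (g x) (g y) ≡ true
    g-red x y xy with punchInView v x | punchInView v y
    ... | at      | at      = contradiction refl (adj⇒≢ G xy)
    ... | at      | other b rewrite g[v] | g∘punchIn b = trans (colSym c w (f b)) (w-red b xy)
    ... | other a | at      rewrite g[v] | g∘punchIn a = w-red a (trans (SimpleGraph.sym G v _) xy)
    ... | other a | other b rewrite g∘punchIn a | g∘punchIn b = red a b xy

  forbidden : ∀ {i} (G : SimpleGraph (suc i)) v → (Fin i → Fin N) → Fin i → Fin N → Bool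
  forbidden G v f u w = (adj G v (punchIn v u) ∧ blueNbhd (f u) w) ∨ (w ≡ᵇ f u)

  ∑-count-forbidden : ∀ {i} (G : SimpleGraph (suc i)) v (f : Fin i → Fin N) B →
    (∀ u → adj G v (punchIn v u) ≡ true → count (blueNbhd (f u)) ≤ B) →
    ∑[ u < i ] count (forbidden G v f u) ≤ i + degree G v * B
  ∑-count-forbidden {i} G v f B small = begin
    ∑[ u < i ] count (forbidden G v f u)             ≤⟨ ∑-mono-≤ count-forbidden ⟩
    ∑[ u < i ] (1 + boolToℕ (a u) * B)               ≡⟨ ∑-distrib-+ (λ _ → 1) (λ u → boolToℕ (a u) * B) ⟩
    ∑[ u < i ] 1 + ∑[ u < i ] (boolToℕ (a u) * B)
      ≡⟨ cong₂ _+_ (trans (∑-const i 1) (*-identityʳ i)) (sym (*-distribʳ-sum B (boolToℕ ∘ a))) ⟩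
    i + count a * B                                  ≡⟨ cong (λ d → i + d * B) (degree≡count-punchIn G v) ⟨
    i + degree G v * B                               ∎
    where
    open ≤-Reasoning
    a : Fin i → Bool
    a = adj G v ∘ punchIn v
    count-forbidden : ∀ u → count (forbidden G v f u) ≤ suc (boolToℕ (a u) * B)
    count-forbidden u with a u in a≡
    ... | false = ≤-reflexive (count-≡ᵇ (f u))
    ... | true  = begin
      count (λ w → blueNbhd (f u) w ∨ (w ≡ᵇ f u)) ≤⟨ count-∨ (blueNbhd (f u)) (_≡ᵇ f u) ⟩
      count (blueNbhd (f u)) + count (_≡ᵇ f u)    ≤⟨ +-mono-≤ (small u a≡) (≤-reflexive (count-≡ᵇ (f u))) ⟩
      B + 1                                       ≡⟨ +-comm B 1 ⟩
      suc B                                       ≡⟨ cong suc (+-identityʳ B) ⟨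
      suc (1 * B)                                 ∎

  greedyStep : ∀ {i} (G : SimpleGraph (suc i)) v B → ((f , _) : ContainsIn c true (deleteVertex G v)) →
    (∀ u → adj G v (punchIn v u) ≡ true → count (blueNbhd (f u)) ≤ B) →
    suc i + degree G v * B ≤ N → ContainsIn c true G
  greedyStep G v B copy@(f , _) small room
    with w , outside ← ∃-outside (forbidden G v f) (≤-trans (s≤s (∑-count-forbidden G v f B small)) room)
    = extendRedCopy G v copy w w∉ w-red
    where
    w∉ : ∀ u → w ≢ f u
    w∉ u = ≡ᵇ≡false⇒≢ (∨-conicalʳ _ _ (outside u))
    w-red : ∀ u → adj G v (punchIn v u) ≡ true → col c (f u) w ≡ true
    w-red u a≡ = ∉blueNbhd⇒red (w∉ u)
      (subst (λ b → b ∧ blueNbhd (f u) w ≡ false) a≡ (∨-conicalˡ _ _ (outside u)))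

  greedyEmbedding : ∀ k {n A} → GreedyRoom N k n A →
    ∀ {i} → i ≤ n → (G : SimpleGraph i) → degreeSum G ≤ A →
    ContainsIn c true G ⊎ ContainsIn c false (Fan (suc k))
  greedyEmbedding k room {zero} _ G _ = inj₁ ([] , (λ { {()} }) , (λ ()))
  greedyEmbedding k room {suc i} i<n G ∑≤A with v , v-min ← ∃-≤-mean (degree G)
    with greedyEmbedding k room (<⇒≤ i<n) (deleteVertex G v) (≤-trans (degreeSum-deleteVertex G v) ∑≤A)
  ... | inj₂ fan = inj₂ fan
  ... | inj₁ copy@(f , _)
    with any? (λ u → (adj G v (punchIn v u) ≟ᵇ true) ×-dec (suc i + 2 * k ≤? count (blueNbhd (f u))))
  ...   | yes (u , _ , big) = largeBlueNbhd⇒redOrFan G k (f u) big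
  ...   | no  ∄big = inj₁ (greedyStep G v (i + 2 * k) copy small room′)
    where
    small : ∀ u → adj G v (punchIn v u) ≡ true → count (blueNbhd (f u)) ≤ i + 2 * k
    small u a≡ = s≤s⁻¹ (≰⇒> (λ big → ∄big (u , a≡ , big)))
    d≤i : degree G v ≤ i
    d≤i = ≤-trans (≤-reflexive (degree≡count-punchIn G v)) (count≤N (adj G v ∘ punchIn v))
    room′ : suc i + degree G v * (i + 2 * k) ≤ N
    room′ = room i (degree G v) i<n (≤-trans v-min ∑≤A) d≤i

2*d≤A : ∀ {i d A} → suc i * d ≤ A → d ≤ i → 2 * d ≤ A
2*d≤A {d = zero}      _    _       = z≤n
2*d≤A {suc i} {suc d} id≤A (s≤s _) =
  ≤-trans (*-monoˡ-≤ (suc d) {2} {suc (suc i)} (s≤s (s≤s z≤n))) id≤A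

d*i*n+A≤A*n : ∀ {i d A n} → suc i ≤ n → suc i * d ≤ A → d * i * n + A ≤ A * n
d*i*n+A≤A*n {i} {d} {A} i<n id≤A with e , refl ← m≤n⇒∃[o]m+o≡n i<n = begin
  d * i * (suc i + e) + A           ≡⟨ expand i d e A ⟩
  suc i * d * i + d * i * e + A     ≤⟨ +-monoˡ-≤ A (+-mono-≤ (*-monoˡ-≤ i id≤A) (*-monoˡ-≤ e di≤A)) ⟩
  A * i + A * e + A                 ≡⟨ collect i e A ⟩
  A * (suc i + e)                   ∎
  where
  open ≤-Reasoning
  expand : ∀ i d e A → d * i * (suc i + e) + A ≡ suc i * d * i + d * i * e + A
  expand = solve-∀
  collect : ∀ i e A → A * i + A * e + A ≡ A * (suc i + e)
  collect = solve-∀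
  di≤A : d * i ≤ A
  di≤A = ≤-trans (*-monoʳ-≤ d (n≤1+n i)) (≤-trans (≤-reflexive (*-comm d (suc i))) id≤A)

greedyStep-bound : ∀ {n A i d} k → i < n → suc i * d ≤ A → d ≤ i →
  (suc i + d * (i + 2 * k)) * n + A ≤ n * n + A * suc k * n
greedyStep-bound {n} {A} {i} {d} k i<n id≤A d≤i = begin
  (suc i + d * (i + 2 * k)) * n + A             ≡⟨ expand i d k n A ⟩
  suc i * n + (d * i * n + A) + 2 * d * k * n   ≤⟨ +-mono-≤ (+-mono-≤ (*-monoˡ-≤ n i<n) (d*i*n+A≤A*n i<n id≤A))
                                                             (*-monoˡ-≤ n (*-monoˡ-≤ k (2*d≤A id≤A d≤i))) ⟩
  n * n + A * n + A * k * n                     ≡⟨ collect n A k ⟩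
  n * n + A * suc k * n                         ∎
  where
  open ≤-Reasoning
  expand : ∀ i d k n A → (suc i + d * (i + 2 * k)) * n + A ≡ suc i * n + (d * i * n + A) + 2 * d * k * n
  expand = solve-∀
  collect : ∀ n A k → n * n + A * n + A * k * n ≡ n * n + A * suc k * n
  collect = solve-∀

*+≤⇒≤/ : ∀ {t n A X} .{{_ : NonZero n}} → t * n + A ≤ X → t ≤ (X ∸ A) / n
*+≤⇒≤/ {t} {n} le = ≤-trans (≤-reflexive (sym (m*n/n≡m t n))) (/-monoˡ-≤ n (m+n≤o⇒m≤o∸n (t * n) le))

≤/⇒*+≤ : ∀ {t n A X} .{{_ : NonZero n}} → A ≤ X → t ≤ (X ∸ A) / n → t * n + A ≤ X
≤/⇒*+≤ {t} {n} {A} {X} A≤X t≤ = begin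
  t * n + A      ≤⟨ +-monoˡ-≤ A (≤-trans (*-monoˡ-≤ n t≤) (m/n*n≤m (X ∸ A) n)) ⟩
  X ∸ A + A      ≡⟨ m∸n+n≡m A≤X ⟩
  X              ∎
  where open ≤-Reasoning

-- Functions are only compared pointwise, so a search over them can only decide predicates
-- that respect pointwise equality.
Searchable : (A : Set) → Rel A 0ℓ → Set₁
Searchable A _≈_ = ∀ {P : Pred A 0ℓ} → P Respects _≈_ → Decidable P → Dec (∃ P)

searchable-Fin : ∀ {n} → Searchable (Fin n) _≡_
searchable-Fin _ = any?

searchable-Bool : Searchable Bool _≡_
searchable-Bool {P} _ P? with P? true | P? false
... | yes p  | _      = yes (true , p)
... | no _   | yes p  = yes (false , p)
... | no ¬pt | no ¬pf = no λ { (true , p) → ¬pt p ; (false , p) → ¬pf p }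

searchable-Π : ∀ {A _≈_} → Reflexive _≈_ → Searchable A _≈_ →
  ∀ {m} → Searchable (Fin m → A) (Pointwise _≈_)
searchable-Π ≈-refl search {zero} resp P? = map′ ([] ,_) (λ (f , p) → resp (λ ()) p) (P? [])
searchable-Π {A} {_≈_} ≈-refl search {suc m} resp P? =
  map′ (λ (a , t , p) → a ∷ t , p) (λ (f , p) → f zero , f ∘ suc , resp ∷-η p)
    (search (λ a≈b (t , p) → t , resp (∷-cong a≈b (λ _ → ≈-refl)) p)
            (λ a → searchable-Π ≈-refl search (λ t≈t′ → resp (∷-cong ≈-refl t≈t′)) (P? ∘ (a ∷_))))
  where
  ∷-cong : ∀ {a b} {t t′ : Fin m → A} → a ≈ b → Pointwise _≈_ t t′ → Pointwise _≈_ (a ∷ t) (b ∷ t′)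
  ∷-cong a≈b _    zero    = a≈b
  ∷-cong _   t≈t′ (suc i) = t≈t′ i
  ∷-η : ∀ {f : Fin (suc m) → A} → Pointwise _≈_ f (f zero ∷ f ∘ suc)
  ∷-η zero    = ≈-refl
  ∷-η (suc i) = ≈-refl

injective? : ∀ {m n} (f : Fin m → Fin n) → Dec (Injective _≡_ _≡_ f)
injective? f =
  map′ (λ inj {x} {y} → inj x y) (λ inj x y → inj) (all? λ x → all? λ y → (f x ≟ f y) →-dec (x ≟ y))

module _ {N n : ℕ} (G : SimpleGraph n) (b : Bool) where

  ContainsIn-resp : (c c′ : Colouring N) → (∀ i j → col c i j ≡ col c′ i j) →
    ContainsIn c b G → ContainsIn c′ b G
  ContainsIn-resp _ _ c≡c′ (f , inj , edges) =
    f , inj , λ i j e → trans (sym (c≡c′ (f i) (f j))) (edges i j e)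

  ContainsIn? : (c : Colouring N) → Dec (ContainsIn c b G)
  ContainsIn? c = searchable-Π refl searchable-Fin respects
    (λ f → injective? f ×-dec all? λ i → all? λ j → (adj G i j ≟ᵇ true) →-dec (col c (f i) (f j) ≟ᵇ b))
    where
    respects : (λ f → Injective _≡_ _≡_ f × (∀ i j → adj G i j ≡ true → col c (f i) (f j) ≡ b))
               Respects Pointwise _≡_
    respects f≗g (inj , edges) =
      (λ {x} {y} gx≡gy → inj (trans (f≗g x) (trans gx≡gy (sym (f≗g y))))) ,
      (λ i j e → trans (cong₂ (col c) (sym (f≗g i)) (sym (f≗g j))) (edges i j e))

module _ {n p : ℕ} (G : SimpleGraph n) (H : SimpleGraph p) where

  mkColouring : ∀ {N} (χ : Fin N → Fin N → Bool) → (∀ i j → χ i j ≡ χ j i) → Colouring N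
  mkColouring χ χ-sym = record { col = χ ; colSym = χ-sym }

  redOrBlue? : ∀ {N} (c : Colouring N) → Dec (ContainsIn c true G ⊎ ContainsIn c false H)
  redOrBlue? c = ContainsIn? G true c ⊎-dec ContainsIn? H false c

  Counterexample : ∀ N → Pred (Fin N → Fin N → Bool) 0ℓ
  Counterexample N χ = Σ (∀ i j → χ i j ≡ χ j i) λ χ-sym →
    ¬ (ContainsIn (mkColouring χ χ-sym) true G ⊎ ContainsIn (mkColouring χ χ-sym) false H)

  counterexample? : ∀ {N} → Decidable (Counterexample N)
  counterexample? χ with all? (λ i → all? (λ j → χ i j ≟ᵇ χ j i))
  ... | yes χ-sym = map′ (χ-sym ,_) (λ (_ , neither) → neither) (¬? (redOrBlue? (mkColouring χ χ-sym)))
  ... | no  ¬sym  = no λ (χ-sym , _) → ¬sym χ-sym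

  counterexample-resp : ∀ {N} → Counterexample N Respects Pointwise (Pointwise _≡_)
  counterexample-resp {N} {χ} {χ′} χ≈χ′ (χ-sym , neither) =
    χ′-sym , neither ∘ Sum.map (ContainsIn-resp G true c′ c back) (ContainsIn-resp H false c′ c back)
    where
    χ′-sym : ∀ i j → χ′ i j ≡ χ′ j i
    χ′-sym i j = trans (sym (χ≈χ′ i j)) (trans (χ-sym i j) (χ≈χ′ j i))
    c c′ : Colouring N
    c  = mkColouring χ χ-sym
    c′ = mkColouring χ′ χ′-sym
    back : ∀ i j → col c′ i j ≡ col c i j
    back i j = sym (χ≈χ′ i j)

  arrows? : ∀ N → Dec (Arrows N G H)
  arrows? N
    with searchable-Π (λ _ → refl) (searchable-Π refl searchable-Bool) counterexample-resp counterexample?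
  ... | yes (χ , χ-sym , neither) = no λ arrows → neither (arrows (mkColouring χ χ-sym))
  ... | no  ∄counterexample       =
    yes λ c → decidable-stable (redOrBlue? c) (λ neither → ∄counterexample (col c , colSym c , neither))

leastWitness : ∀ {P : Pred ℕ 0ℓ} → Decidable P → ∀ {n} → P n → ∃ λ r → P r × (∀ {m} → m < r → ¬ P m)
leastWitness {P} P? {n} = <-rec (λ n → P n → Least) step n
  where
  Least : Set
  Least = ∃ λ r → P r × (∀ {m} → m < r → ¬ P m)
  step : ∀ n → (∀ {m} → m < n → P m → Least) → P n → Least
  step n rec pn with anyUpTo? P? n
  ... | yes (m , m<n , pm) = rec m<n pm
  ... | no  ∄smaller       = n , pn , λ m<n pm → ∄smaller (_ , m<n , pm)

ramseyNumber≤ : ∀ {n p} (G : SimpleGraph n) (H : SimpleGraph p) N → 0 < N → Arrows N G H →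
  Σ ℕ λ r → IsRamseyNumber G H r × r ≤ N
ramseyNumber≤ G H N 0<N arrows
  with r , (0<r , arrows-r) , minimal ← leastWitness (λ m → (0 <? m) ×-dec arrows? G H m) (0<N , arrows)
  = r , (0<r , arrows-r , λ M 0<M M<r arrows-M → minimal M<r (0<M , arrows-M)) ,
    ≮⇒≥ (λ N<r → minimal N<r (0<N , arrows))

lemma2p6 : (n : ℕ) → 2 ≤ n → (G : SimpleGraph n) → (∀ v → ¬ Isolated G v) →
    (k : ℕ) → 1 ≤ k →
    Σ ℕ λ r → IsRamseyNumber G (Fan k) r ×
      (r * n + 2 * edgeCount G ≤ n * n + 2 * edgeCount G * k * n)
lemma2p6 n@(suc _) _ G _ k@(suc k′) _ =
  Product.map₂ (Product.map₂ (≤/⇒*+≤ A≤X)) (ramseyNumber≤ G (Fan k) N₀ 0<N₀ arrows)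
  where
  A X N₀ : ℕ
  A  = 2 * edgeCount G
  X  = n * n + A * k * n
  N₀ = (X ∸ A) / n
  A≤X : A ≤ X
  A≤X = ≤-trans (m≤m*n A k) (≤-trans (m≤m*n (A * k) n) (m≤n+m (A * k * n) (n * n)))
  room : GreedyRoom N₀ k′ n A
  room i d i<n id≤A d≤i = *+≤⇒≤/ {A = A} {X} (greedyStep-bound k′ i<n id≤A d≤i)
  0<N₀ : 0 < N₀
  0<N₀ = room 0 0 (s≤s z≤n) z≤n z≤n
  arrows : Arrows N₀ G (Fan k)
  arrows c = greedyEmbedding c k′ room ≤-refl G (≤-reflexive (handshake G))
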